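{- Let $\mathbb{M}$ be a multiparty session and let $\mathcal{P}$ be the fixed point of the following procedure: start with $\mathcal{P}_0=\{\{\mathsf{p}\}\mid \mathsf{p}\in\mathrm{prt}(\mathbb{M})\}$, and build $\mathcal{P}_{i+1}$ from $\mathcal{P}_i$ by replacing two sets $\mathbf{P},\mathbf{P}'\in\mathcal{P}_i$ with the single set $\mathbf{P}\cup\mathbf{P}'$ whenever there is $\mathsf{p}[\![P]\!]\in\mathbb{M}$ with $\mathsf{p}\in\mathbf{P}$ and $\mathsf{q}\in\mathbf{P}'\cap\mathrm{prt}(P)$ such that either $P$ is not $\mathbf{P}$-connecting or $\mathsf{q}$ is not a connector for the subsession of $\mathbb{M}$ whose set of participants is $\mathbf{P}'$. Then $\mathbb{M}$ is $\mathcal{P}$-modularisable.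
   Context: Processes are coinductively defined (regular terms) by $P ::= \mathbf{0} \mid \Sigma_{i\in I}\pi_i.P_i$ with $I$ finite nonempty, where action prefixes are $\pi ::= \mathsf{p}?\lambda \mid \mathsf{p}!\lambda$ (input/output of message $\lambda$ with participant $\mathsf{p}$). $\mathrm{prt}(\mathsf{p}?\lambda)=\mathrm{prt}(\mathsf{p}!\lambda)=\{\mathsf{p}\}$, $\mathrm{prt}(\mathbf{0})=\emptyset$, $\mathrm{prt}(\Sigma_{i\in I}\pi_i.P_i)=\bigcup_i\mathrm{prt}(\pi_i)\cup\bigcup_i\mathrm{prt}(P_i)$. A multiparty session is $\mathbb{M}=\mathsf{p}_1[\![P_1]\!]\parallel\cdots\parallel\mathsf{p}_n[\![P_n]\!]$ with distinct participants; $\mathsf{p}[\![P]\!]\in\mathbb{M}$ means $\mathbb{M}\equiv\mathsf{p}[\![P]\!]\parallel\mathbb{M}'$ with $P\neq\mathbf{0}$, and $\mathrm{prt}(\mathbb{M})=\{\mathsf{p}\mid \mathsf{p}[\![P]\!]\in\mathbb{M}\}$. A subsession $\mathbb{M}'\subseteq\mathbb{M}$ means $\mathsf{p}[\![P]\!]\in\mathbb{M}'$ implies $\mathsf{p}[\![P]\!]\in\mathbb{M}$. Given a set of participants $\mathbf{P}$, a process $P$ is $\mathbf{P}$-connecting if for every subprocess $\Sigma_{i\in I}\pi_i.P_i$ of $P$, $\mathrm{prt}(\pi_j)\not\subseteq\mathbf{P}$ for some $j\in I$ implies $\mathrm{prt}(\pi_i)=\mathrm{prt}(\pi_j)$ for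 all $i\in I$. If $\mathsf{p}[\![P]\!]\in\mathbb{M}$, $\mathsf{p}$ is a connector for $\mathbb{M}$ if $P$ is $\mathrm{prt}(\mathbb{M})$-connecting and some $\mathsf{q}\in\mathrm{prt}(P)$ has $\mathsf{q}\notin\mathrm{prt}(\mathbb{M})$. Given a partition $\mathcal{P}=\{\mathbf{P}_k\}_{k\in K}$ of a finite set of participant names, a $\mathcal{P}$-partition of $\mathbb{M}$ is a partition $\{\mathbb{M}_h\}_{h\in H}$ of $\mathbb{M}$ into subsessions with disjoint participant sets covering $\mathrm{prt}(\mathbb{M})$, $H\subseteq K$ and $\mathrm{prt}(\mathbb{M}_h)\subseteq\mathbf{P}_h$. A $\mathcal{P}$-modularisation of $\mathbb{M}$ is a $\mathcal{P}$-partition $\{\mathbb{M}_h\}_{h\in H}$ such that for all $h$: (i) if $\mathsf{p}[\![P]\!]\in\mathbb{M}_h$ then either $\mathsf{p}$ is a connector of $\mathbb{M}_h$ or every $\mathsf{q}\in\mathrm{prt}(P)$ with $\mathsf{q}\in\mathrm{prt}(\mathbb{M})$ lies in $\mathrm{prt}(\mathbb{M}_h)$; (ii) for each connector $\mathsf{p}[\![P]\!]\in\mathbb{M}_h$ and each $\mathsf{q}\in\mathrm{prt}(P)\setminus\mathrm{prt}(\mathbb{M}_h)$, if $\mathsf{q}\in\mathrm{prt}(\mathbb{M}_k)$ then $\mathsf{q}$ is a connector for $\mathbb{M}_k$. $\mathbb{M}$ is $\mathcal{P}$-modularisable if such a modularisation exists. -}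

module Defs where

open import Data.Nat using (ℕ; _≟_)
open import Data.Fin using (Fin)
open import Data.Vec using (Vec; lookup)
open import Data.List using (List; []; _∷_; map; filter; length; _++_)
open import Data.List.NonEmpty using (List⁺; toList)
open import Data.List.Membership.Propositional using (_∈_)
open import Data.List.Membership.DecPropositional _≟_ using (_∈?_)
open import Data.List.Relation.Unary.Unique.Propositional using (Unique)
open import Data.List.Relation.Binary.Permutation.Propositional using (_↭_)
open import Data.Product using (Σ; ∃; ∃-syntax; _×_; _,_; proj₁; proj₂)
open import Data.Sum using (_⊎_)
open import Relation.Nullary using (¬_; Dec; yes; no; ¬?)

open import Relation.Binary.PropositionalEquality using (_≡_; refl)
open import Relation.Binary.Construct.Closure.ReflexiveTransitive using (Star)
open import Data.List.Relation.Unary.Any using (Any)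

Participant : Set
Participant = ℕ

Label : Set
Label = ℕ

data Action : Set where
  inp : Participant → Label → Action
  out : Participant → Label → Action

-- prt(π)  (a singleton; we return its unique element)
actPrt : Action → Participant
actPrt (inp p _) = p
actPrt (out p _) = p

-- Processes as regular terms, represented by finite graphs:
-- a node is either 0 or a finite nonempty sum Σ_{i∈I} π_i . P_i whose
-- continuations are (pointers to) nodes of the graph.

data Node (n : ℕ) : Set where
  𝟎   : Node n
  sum : List⁺ (Action × Fin n) → Node n

record Proc : Set where
  constructor proc
  field
    size  : ℕ
    graph : Vec (Node size) size
    root  : Fin size
open Proc public

rootNode : (P : Proc) → Node (size P)
rootNode P = lookup (graph P) (root P)

-- Reachability of nodes (the subprocesses of P are the reachable nodes).
data Reach {n : ℕ} (g : Vec (Node n) n) : Fin n → Fin n → Set where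
  here : ∀ {i} → Reach g i i
  step : ∀ {i j k bs a} → lookup g i ≡ sum bs → (a , j) ∈ toList bs →
         Reach g j k → Reach g i k

SubSum : (P : Proc) → List⁺ (Action × Fin (size P)) → Set
SubSum P bs = ∃[ i ] (Reach (graph P) (root P) i × lookup (graph P) i ≡ sum bs)

_∈prt_ : Participant → Proc → Set
q ∈prt P = ∃[ bs ] (SubSum P bs × Any (λ b → actPrt (proj₁ b) ≡ q) (toList bs))

Connecting : (Participant → Set) → Proc → Set
Connecting S P = ∀ bs → SubSum P bs →
  ∀ b → b ∈ toList bs → ¬ S (actPrt (proj₁ b)) →
  ∀ b' → b' ∈ toList bs → actPrt (proj₁ b') ≡ actPrt (proj₁ b)

Session : Set
Session = List (Participant × Proc)

WfSession : Session → Set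
WfSession M = Unique (map proj₁ M)

IsZero? : ∀ {n} (x : Node n) → Dec (x ≡ 𝟎)
IsZero? 𝟎 = yes refl
IsZero? (sum _) = no (λ ())

_⟦_⟧∈_ : Participant → Proc → Session → Set
p ⟦ P ⟧∈ M = (p , P) ∈ M × ¬ (rootNode P ≡ 𝟎)

prtS : Session → Participant → Set
prtS M p = ∃[ P ] (p ⟦ P ⟧∈ M)

prtList : Session → List Participant
prtList M = map proj₁ (filter (λ e → ¬? (IsZero? (rootNode (proj₂ e)))) M)

_⊆S_ : Session → Session → Set
M' ⊆S M = ∀ p P → p ⟦ P ⟧∈ M' → p ⟦ P ⟧∈ M

Connector : Session → Participant → Set
Connector M p = ∃[ P ] (p ⟦ P ⟧∈ M × Connecting (prtS M) P ×
                        ∃[ q ] (q ∈prt P × ¬ prtS M q))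

restrict : Session → List Participant → Session
restrict M B = filter (λ e → proj₁ e ∈? B) M

Partition : Set
Partition = List (List Participant)

block : (𝒫 : Partition) → Fin (length 𝒫) → List Participant
block 𝒫 k = Data.List.lookup 𝒫 k

-- P-partition of M, indexed over K = Fin (length 𝒫); M_h for h ∉ H is
-- simply a session with no (non-0) participants.
record PPartition (M : Session) (𝒫 : Partition)
                  (Ms : Fin (length 𝒫) → Session) : Set where
  field
    wf       : ∀ h → WfSession (Ms h)
    sub      : ∀ h → Ms h ⊆S M
    cover    : ∀ p → prtS M p → ∃[ h ] prtS (Ms h) p
    disjoint : ∀ h h' p → prtS (Ms h) p → prtS (Ms h') p → h ≡ h'
    inBlock  : ∀ h p → prtS (Ms h) p → p ∈ block 𝒫 h

record PModularisation (M : Session) (𝒫 : Partition)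
                       (Ms : Fin (length 𝒫) → Session) : Set where
  field
    partition : PPartition M 𝒫 Ms
    condI  : ∀ h p P → p ⟦ P ⟧∈ Ms h →
             Connector (Ms h) p ⊎
             (∀ q → q ∈prt P → prtS M q → prtS (Ms h) q)
    condII : ∀ h p → Connector (Ms h) p →
             ∀ P → p ⟦ P ⟧∈ Ms h →
             ∀ q → q ∈prt P → ¬ prtS (Ms h) q →
             ∀ k → prtS (Ms k) q → Connector (Ms k) q

Modularisable : Session → Partition → Set
Modularisable M 𝒫 = ∃[ Ms ] PModularisation M 𝒫 Ms

𝒫₀ : Session → Partition
𝒫₀ M = map (λ p → p ∷ []) (prtList M)

MergeCond : Session → List Participant → List Participant → Set
MergeCond M B B' = ∃[ p ] ∃[ P ] ∃[ q ]
  (p ⟦ P ⟧∈ M × p ∈ B × q ∈ B' × q ∈prt P ×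
   (¬ Connecting (_∈ B) P ⊎ ¬ Connector (restrict M B') q))

Step : Session → Partition → Partition → Set
Step M 𝒫 𝒫' = ∃[ B ] ∃[ B' ] ∃[ rest ]
  (𝒫 ↭ (B ∷ B' ∷ rest) × 𝒫' ≡ (B ++ B') ∷ rest × MergeCond M B B')

Steps : Session → Partition → Partition → Set
Steps M = Star (Step M)

Final : Session → Partition → Set
Final M 𝒫 = ¬ (∃[ 𝒫' ] Step M 𝒫 𝒫')

module Submission where

-- At a fixed point, let M_h be the restriction of M to the h-th block; merge steps preserve
-- that the blocks partition prt(M), so this is a partition of M. Both conditions of a
-- modularisation hold because the corresponding merge did not fire: if p⟦P⟧ lies in block h
-- and P mentions a participant q of another block k, then P is (block h)-connecting and q is
-- a connector for M_k. Processes are finite graphs, so whether some participant of P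
-- satisfies a decidable property is decided by a depth-first search; this turns the double
-- negations supplied by the absent merges into the positive statements required.

open import Defs
open import Data.Nat using (ℕ; _≟_)
open import Data.Fin using (Fin; zero; suc)
open import Data.Fin.Properties using () renaming (_≟_ to _≟ᶠ_)
open import Data.Fin.Subset using (Subset; ⊤; _-_; _⊂_; _⊆_) renaming (_∈_ to _∈ˢ_)
open import Data.Fin.Subset.Properties using (∈⊤; p─q⊆p; x∈p∧x≢y⇒x∈p-y; x∈p⇒p-x⊂p)
  renaming (_∈?_ to _∈ˢ?_)
open import Data.Fin.Subset.Induction using (Acc; acc; ⊂-wellFounded)
open import Data.Vec using (Vec; lookup)
open import Data.List as List using (List; []; _∷_; length; map; filter; _++_; concat)
open import Data.List.NonEmpty using (toList)
open import Data.List.Properties using (++-assoc; concat-map-[_])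
open import Data.List.Membership.Propositional using (_∈_; _∉_; lose; find)
open import Data.List.Membership.Propositional.Properties
  using (∈-lookup; ∈-map⁺; ∈-map⁻; ∈-filter⁺; ∈-filter⁻; ∈-concat⁺′; ∈-concat⁻; ∈-++⁺ʳ)
open import Data.List.Membership.DecPropositional _≟_ using (_∈?_)
open import Data.List.Relation.Unary.Any as Any using (Any; here; there; any?)
open import Data.List.Relation.Unary.Any.Properties using (lookup-index)
open import Data.List.Relation.Unary.All as All using ()
open import Data.List.Relation.Unary.AllPairs using (_∷_)
import Data.List.Relation.Unary.AllPairs.Properties as AllPairs
open import Data.List.Relation.Unary.Unique.Propositional using (Unique)
open import Data.List.Relation.Binary.Permutation.Propositional
  using (_↭_; refl; prep; swap; trans; ↭-sym; ↭⇒↭ₛ)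
open import Data.List.Relation.Binary.Permutation.Propositional.Properties
  using (++⁺ˡ; shifts; ∈-resp-↭)
open import Data.List.Relation.Binary.Permutation.Setoid.Properties using (Unique-resp-↭)
open import Relation.Binary.Construct.Closure.ReflexiveTransitive using (ε; _◅_)
open import Data.Product using (∃-syntax; _×_; _,_; proj₁; proj₂)
open import Data.Sum using (_⊎_; inj₁; inj₂)
open import Data.Empty using (⊥-elim)
open import Function using (_∘_)
open import Relation.Unary using (Decidable)
open import Relation.Nullary using (¬_; Dec; yes; no; ¬?)
open import Relation.Nullary.Decidable using (map′; _×-dec_; decidable-stable)
open import Relation.Binary.PropositionalEquality
  using (_≡_; _≢_; refl; sym; subst; cong; setoid)


Unique-map-filter : ∀ {A B : Set} {P : A → Set} (P? : Decidable P) (f : A → B) {xs : List A} →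
                    Unique (map f xs) → Unique (map f (filter P? xs))
Unique-map-filter P? f = AllPairs.map⁺ ∘ AllPairs.filter⁺ P? ∘ AllPairs.map⁻

Unique-proj₁⇒functional : ∀ {A B : Set} {xs : List (A × B)} {x : A} {y y′ : B} →
                          Unique (map proj₁ xs) → (x , y) ∈ xs → (x , y′) ∈ xs → y ≡ y′
Unique-proj₁⇒functional _        (here refl) (here refl) = refl
Unique-proj₁⇒functional (x∉ ∷ _) (here refl) (there m)   = ⊥-elim (All.lookup x∉ (∈-map⁺ proj₁ m) refl)
Unique-proj₁⇒functional (x∉ ∷ _) (there m)   (here refl) = ⊥-elim (All.lookup x∉ (∈-map⁺ proj₁ m) refl)
Unique-proj₁⇒functional (_ ∷ u)  (there m)   (there m′)  = Unique-proj₁⇒functional u m m′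

Unique-++⇒disjoint : ∀ {A : Set} (xs : List A) {ys : List A} {x : A} →
                     Unique (xs ++ ys) → x ∈ xs → x ∉ ys
Unique-++⇒disjoint (_ ∷ xs) (x∉ ∷ _) (here refl) x∈ys = All.lookup x∉ (∈-++⁺ʳ xs x∈ys) refl
Unique-++⇒disjoint (_ ∷ xs) (_ ∷ u)  (there x∈)  x∈ys = Unique-++⇒disjoint xs u x∈ x∈ys

Unique-++⁻ʳ : ∀ {A : Set} (xs : List A) {ys : List A} → Unique (xs ++ ys) → Unique ys
Unique-++⁻ʳ []       u       = u
Unique-++⁻ʳ (_ ∷ xs) (_ ∷ u) = Unique-++⁻ʳ xs u

Unique-concat⇒lookup-disjoint : ∀ {A : Set} (xss : List (List A)) {x : A} (h h′ : Fin (length xss)) →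
  Unique (concat xss) → x ∈ List.lookup xss h → x ∈ List.lookup xss h′ → h ≡ h′
Unique-concat⇒lookup-disjoint (xs ∷ xss) zero    zero     u x∈ x∈′ = refl
Unique-concat⇒lookup-disjoint (xs ∷ xss) zero    (suc j)  u x∈ x∈′ =
  ⊥-elim (Unique-++⇒disjoint xs u x∈ (∈-concat⁺′ x∈′ (∈-lookup {xs = xss} j)))
Unique-concat⇒lookup-disjoint (xs ∷ xss) (suc i) zero     u x∈ x∈′ =
  ⊥-elim (Unique-++⇒disjoint xs u x∈′ (∈-concat⁺′ x∈ (∈-lookup {xs = xss} i)))
Unique-concat⇒lookup-disjoint (xs ∷ xss) (suc i) (suc j)  u x∈ x∈′ =
  cong suc (Unique-concat⇒lookup-disjoint xss i j (Unique-++⁻ʳ xs u) x∈ x∈′)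

∈-concat⇒∈-lookup : ∀ {A : Set} (xss : List (List A)) {x : A} →
                    x ∈ concat xss → ∃[ h ] (x ∈ List.lookup xss h)
∈-concat⇒∈-lookup xss x∈ = let x∈xs = ∈-concat⁻ xss x∈ in Any.index x∈xs , lookup-index x∈xs

concat-↭ : ∀ {A : Set} {xss yss : List (List A)} → xss ↭ yss → concat xss ↭ concat yss
concat-↭ refl           = refl
concat-↭ (prep xs p)    = ++⁺ˡ xs (concat-↭ p)
concat-↭ (swap xs ys p) = trans (shifts xs ys) (++⁺ˡ ys (++⁺ˡ xs (concat-↭ p)))
concat-↭ (trans p q)    = trans (concat-↭ p) (concat-↭ q)

lookup-↭ : ∀ {A : Set} (xs : List A) (h : Fin (length xs)) → ∃[ rest ] (xs ↭ List.lookup xs h ∷ rest)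
lookup-↭ (x ∷ xs) zero    = xs , refl
lookup-↭ (x ∷ xs) (suc i) with rest , p ← lookup-↭ xs i = x ∷ rest , trans (prep x p) (swap x _ refl)

lookup₂-↭ : ∀ {A : Set} (xs : List A) (h h′ : Fin (length xs)) → h ≢ h′ →
            ∃[ rest ] (xs ↭ List.lookup xs h ∷ List.lookup xs h′ ∷ rest)
lookup₂-↭ (x ∷ xs) zero    zero    h≢h′ = ⊥-elim (h≢h′ refl)
lookup₂-↭ (x ∷ xs) zero    (suc j) h≢h′ with rest , p ← lookup-↭ xs j = rest , prep x p
lookup₂-↭ (x ∷ xs) (suc i) zero    h≢h′ with rest , p ← lookup-↭ xs i =
  rest , trans (prep x p) (swap x _ refl)
lookup₂-↭ (x ∷ xs) (suc i) (suc j) h≢h′ with rest , p ← lookup₂-↭ xs i j (h≢h′ ∘ cong suc) =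
  x ∷ rest , trans (prep x p) (trans (swap x _ refl) (prep _ (swap x _ refl)))


branches : ∀ {n} → Node n → List (Action × Fin n)
branches 𝟎        = []
branches (sum bs) = toList bs

∈-branches⁺ : ∀ {n} {x : Node n} {bs b} → x ≡ sum bs → b ∈ toList bs → b ∈ branches x
∈-branches⁺ refl b∈ = b∈

∈-branches⁻ : ∀ {n} {b : Action × Fin n} (x : Node n) →
              b ∈ branches x → ∃[ bs ] (x ≡ sum bs × b ∈ toList bs)
∈-branches⁻ (sum bs) b∈ = bs , refl , b∈

module Reachability {n : ℕ} (g : Vec (Node n) n) where

  data ReachWithin (U : Subset n) : Fin n → Fin n → Set where
    here : ∀ {i} → i ∈ˢ U → ReachWithin U i i
    step : ∀ {i j k a} → i ∈ˢ U → (a , j) ∈ branches (lookup g i) →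
           ReachWithin U j k → ReachWithin U i k

  ReachWithin-head : ∀ {U i k} → ReachWithin U i k → i ∈ˢ U
  ReachWithin-head (here i∈)       = i∈
  ReachWithin-head (step i∈ _ _)   = i∈

  ReachWithin-mono : ∀ {U V i k} → U ⊆ V → ReachWithin U i k → ReachWithin V i k
  ReachWithin-mono U⊆V (here i∈)       = here (U⊆V i∈)
  ReachWithin-mono U⊆V (step i∈ b∈ r)  = step (U⊆V i∈) b∈ (ReachWithin-mono U⊆V r)

  Reach⇒ReachWithin⊤ : ∀ {i k} → Reach g i k → ReachWithin ⊤ i k
  Reach⇒ReachWithin⊤ here           = here ∈⊤
  Reach⇒ReachWithin⊤ (step e b∈ r)  = step ∈⊤ (∈-branches⁺ e b∈) (Reach⇒ReachWithin⊤ r)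

  ReachWithin⇒Reach : ∀ {U i k} → ReachWithin U i k → Reach g i k
  ReachWithin⇒Reach (here _) = here
  ReachWithin⇒Reach {i = i} (step _ b∈ r) with bs , e , b∈bs ← ∈-branches⁻ (lookup g i) b∈ =
    step e b∈bs (ReachWithin⇒Reach r)

  ReachNoReturn : Subset n → Fin n → Fin n → Set
  ReachNoReturn U i k = i ≡ k ⊎ ∃[ b ] (b ∈ branches (lookup g i) × ReachWithin (U - i) (proj₂ b) k)

  -- A path through i is cut at its last visit to i.
  ReachWithin-split : ∀ {U j k} i → ReachWithin U j k → ReachWithin (U - i) j k ⊎ ReachNoReturn U i k
  ReachWithin-split {j = j} i (here j∈) with j ≟ᶠ i
  ... | yes refl = inj₂ (inj₁ refl)
  ... | no j≢i   = inj₁ (here (x∈p∧x≢y⇒x∈p-y j∈ j≢i))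
  ReachWithin-split {j = j} i (step j∈ b∈ r) with ReachWithin-split i r
  ... | inj₂ leave = inj₂ leave
  ... | inj₁ r′ with j ≟ᶠ i
  ...   | yes refl = inj₂ (inj₂ (_ , b∈ , r′))
  ...   | no j≢i   = inj₁ (step (x∈p∧x≢y⇒x∈p-y j∈ j≢i) b∈ r′)

  module _ {D : Fin n → Set} (D? : Decidable D) where

    ReachesWithin : Subset n → Fin n → Set
    ReachesWithin U i = ∃[ k ] (ReachWithin U i k × D k)

    ViaBranch : Subset n → Fin n → Set
    ViaBranch U i = Any (ReachesWithin (U - i) ∘ proj₂) (branches (lookup g i))

    ViaBranch⇒ReachesWithin : ∀ {U i} → i ∈ˢ U → ViaBranch U i → ReachesWithin U i
    ViaBranch⇒ReachesWithin {U} i∈ via with _ , b∈ , (k , r , d) ← find via =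
      k , step i∈ b∈ (ReachWithin-mono (p─q⊆p U _) r) , d

    ReachesWithin⇒ViaBranch : ∀ {U i} → ¬ D i → ReachesWithin U i → ViaBranch U i
    ReachesWithin⇒ViaBranch ¬d (k , here _ , d) = ⊥-elim (¬d d)
    ReachesWithin⇒ViaBranch {i = i} ¬d (k , step _ b∈ r , d) with ReachWithin-split i r
    ... | inj₁ r′                      = lose b∈ (k , r′ , d)
    ... | inj₂ (inj₁ refl)             = ⊥-elim (¬d d)
    ... | inj₂ (inj₂ (_ , b′∈ , r′))   = lose b′∈ (k , r′ , d)

    -- Depth-first search, by well-founded recursion on the set U of unvisited nodes.
    reachesWithin? : ∀ U → Acc _⊂_ U → Decidable (ReachesWithin U)
    reachesWithin? U (acc rec) i with i ∈ˢ? U | D? i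
    ... | no i∉  | _      = no λ (_ , r , _) → i∉ (ReachWithin-head r)
    ... | yes i∈ | yes d  = yes (i , here i∈ , d)
    ... | yes i∈ | no ¬d  =
      map′ (ViaBranch⇒ReachesWithin i∈) (ReachesWithin⇒ViaBranch ¬d)
           (any? (reachesWithin? (U - i) (rec (x∈p⇒p-x⊂p i∈)) ∘ proj₂) (branches (lookup g i)))

    reaches? : Decidable (λ i → ∃[ k ] (Reach g i k × D k))
    reaches? i = map′ (λ (k , r , d) → k , ReachWithin⇒Reach r , d)
                      (λ (k , r , d) → k , Reach⇒ReachWithin⊤ r , d)
                      (reachesWithin? ⊤ (⊂-wellFounded ⊤) i)

anyPrt? : (P : Proc) {T : Participant → Set} → Decidable T → Dec (∃[ q ] (q ∈prt P × T q))
anyPrt? P {T} T? = map′ toPrt fromPrt (reaches? D? (root P))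
  where
    open Reachability (graph P)

    TBranch : Action × Fin (size P) → Set
    TBranch b = T (actPrt (proj₁ b))

    D : Fin (size P) → Set
    D i = Any TBranch (branches (lookup (graph P) i))

    D? : Decidable D
    D? i = any? (T? ∘ actPrt ∘ proj₁) (branches (lookup (graph P) i))

    toPrt : ∃[ k ] (Reach (graph P) (root P) k × D k) → ∃[ q ] (q ∈prt P × T q)
    toPrt (k , r , d)
      with b , b∈ , t ← find d
      with bs , e , b∈bs ← ∈-branches⁻ (lookup (graph P) k) b∈ =
      actPrt (proj₁ b) , (bs , (k , r , e) , lose b∈bs refl) , t

    fromPrt : ∃[ q ] (q ∈prt P × T q) → ∃[ k ] (Reach (graph P) (root P) k × D k)
    fromPrt (q , (bs , (k , r , e) , q∈) , t) with b , b∈bs , refl ← find q∈ =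
      k , r , lose (∈-branches⁺ e b∈bs) t

Connecting-stable : ∀ S {P} → ¬ ¬ Connecting S P → Connecting S P
Connecting-stable _ ¬¬conn bs sub b b∈ b∉S b′ b′∈ =
  decidable-stable (actPrt (proj₁ b′) ≟ actPrt (proj₁ b))
                   (λ ≢ → ¬¬conn (λ conn → ≢ (conn bs sub b b∈ b∉S b′ b′∈)))

Connecting-mono : ∀ {S S′ P} → (∀ {q} → S q → S′ q) → Connecting S P → Connecting S′ P
Connecting-mono S⊆S′ conn bs sub b b∈ b∉S′ = conn bs sub b b∈ (b∉S′ ∘ S⊆S′)


isActive? : Decidable (λ (e : Participant × Proc) → ¬ rootNode (proj₂ e) ≡ 𝟎)
isActive? e = ¬? (IsZero? (rootNode (proj₂ e)))

module _ {M : Session} where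

  prtList⁺ : ∀ {p} → prtS M p → p ∈ prtList M
  prtList⁺ (P , e∈ , active) = ∈-map⁺ proj₁ (∈-filter⁺ isActive? e∈ active)

  prtList⁻ : ∀ {p} → p ∈ prtList M → prtS M p
  prtList⁻ p∈ with (_ , P) , e∈ , refl ← ∈-map⁻ proj₁ p∈ = P , ∈-filter⁻ isActive? e∈

  prtList-unique : WfSession M → Unique (prtList M)
  prtList-unique = Unique-map-filter isActive? proj₁

  ⟦⟧∈-functional : ∀ {p P Q} → WfSession M → p ⟦ P ⟧∈ M → p ⟦ Q ⟧∈ M → P ≡ Q
  ⟦⟧∈-functional wf (e∈ , _) (e∈′ , _) = Unique-proj₁⇒functional wf e∈ e∈′

  module _ {B : List Participant} where

    ⟦⟧∈-restrict⁺ : ∀ {p P} → p ⟦ P ⟧∈ M → p ∈ B → p ⟦ P ⟧∈ restrict M B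
    ⟦⟧∈-restrict⁺ (e∈ , active) p∈B = ∈-filter⁺ (λ e → proj₁ e ∈? B) e∈ p∈B , active

    ⟦⟧∈-restrict⁻ : ∀ {p P} → p ⟦ P ⟧∈ restrict M B → p ⟦ P ⟧∈ M × p ∈ B
    ⟦⟧∈-restrict⁻ (e∈ , active) with e∈M , p∈B ← ∈-filter⁻ (λ e → proj₁ e ∈? B) e∈ =
      (e∈M , active) , p∈B

    prtS-restrict⁺ : ∀ {p} → prtS M p → p ∈ B → prtS (restrict M B) p
    prtS-restrict⁺ (P , p∈M) p∈B = P , ⟦⟧∈-restrict⁺ p∈M p∈B

    restrict-wf : WfSession M → WfSession (restrict M B)
    restrict-wf = Unique-map-filter (λ e → proj₁ e ∈? B) proj₁

prtS? : (M : Session) → Decidable (prtS M)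
prtS? M p = map′ prtList⁻ prtList⁺ (p ∈? prtList M)

Connector-stable : ∀ {M q Q} → WfSession M → q ⟦ Q ⟧∈ M → ¬ ¬ Connector M q → Connector M q
Connector-stable {M} {q} {Q} wf q∈ ¬¬conn with anyPrt? Q (¬? ∘ prtS? M)
... | yes (r , r∈Q , r∉M) = Q , q∈ , Connecting-stable (prtS M) ¬¬connQ , r , r∈Q , r∉M
  where
    ¬¬connQ : ¬ ¬ Connecting (prtS M) Q
    ¬¬connQ ¬conn = ¬¬conn λ (Q′ , q∈′ , conn , _) →
      ¬conn (subst (Connecting (prtS M)) (⟦⟧∈-functional wf q∈′ q∈) conn)
... | no ∄r = ⊥-elim (¬¬conn λ (Q′ , q∈′ , _ , r , r∈Q′ , r∉M) →
  ∄r (r , subst (r ∈prt_) (⟦⟧∈-functional wf q∈′ q∈) r∈Q′ , r∉M))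


CoversPrt : Session → Partition → Set
CoversPrt M 𝒫 = concat 𝒫 ↭ prtList M

𝒫₀-covers : (M : Session) → CoversPrt M (𝒫₀ M)
𝒫₀-covers M = subst (_↭ prtList M) (sym (concat-map-[ prtList M ])) refl

Step-covers : ∀ {M 𝒫 𝒫′} → Step M 𝒫 𝒫′ → CoversPrt M 𝒫 → CoversPrt M 𝒫′
Step-covers {M} (B , B′ , rest , 𝒫↭ , refl , _) covers =
  subst (_↭ prtList M) (sym (++-assoc B B′ (concat rest))) (trans (↭-sym (concat-↭ 𝒫↭)) covers)

Steps-covers : ∀ {M 𝒫 𝒫′} → Steps M 𝒫 𝒫′ → CoversPrt M 𝒫 → CoversPrt M 𝒫′
Steps-covers ε                covers = covers
Steps-covers (merge ◅ merges) covers = Steps-covers merges (Step-covers merge covers)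

module FixedPoint (M : Session) (wf : WfSession M) (𝒫 : Partition)
                  (covers : CoversPrt M 𝒫) (final : Final M 𝒫) where

  Ms : Fin (length 𝒫) → Session
  Ms h = restrict M (block 𝒫 h)

  block⊆prt : ∀ {h p} → p ∈ block 𝒫 h → prtS M p
  block⊆prt {h} p∈ = prtList⁻ (∈-resp-↭ covers (∈-concat⁺′ p∈ (∈-lookup {xs = 𝒫} h)))

  prtS-Ms⁺ : ∀ {h p} → p ∈ block 𝒫 h → prtS (Ms h) p
  prtS-Ms⁺ p∈ = prtS-restrict⁺ (block⊆prt p∈) p∈

  ⟦⟧∈-Ms⁻ : ∀ {h p P} → p ⟦ P ⟧∈ Ms h → p ⟦ P ⟧∈ M × p ∈ block 𝒫 h
  ⟦⟧∈-Ms⁻ = ⟦⟧∈-restrict⁻ {M = M}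

  prtS-Ms⁻ : ∀ {h p} → prtS (Ms h) p → p ∈ block 𝒫 h
  prtS-Ms⁻ (_ , p∈) = proj₂ (⟦⟧∈-Ms⁻ p∈)

  blockOf : ∀ {p} → prtS M p → ∃[ h ] (p ∈ block 𝒫 h)
  blockOf p∈ = ∈-concat⇒∈-lookup 𝒫 (∈-resp-↭ (↭-sym covers) (prtList⁺ p∈))

  blocks-disjoint : ∀ {p} h h′ → p ∈ block 𝒫 h → p ∈ block 𝒫 h′ → h ≡ h′
  blocks-disjoint h h′ = Unique-concat⇒lookup-disjoint 𝒫 h h′ blocks-unique
    where
      blocks-unique : Unique (concat 𝒫)
      blocks-unique = Unique-resp-↭ (setoid ℕ) (↭⇒↭ₛ (↭-sym covers)) (prtList-unique wf)

  outside⇒≢ : ∀ {h h′ p} → p ∈ block 𝒫 h′ → ¬ prtS (Ms h) p → h ≢ h′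
  outside⇒≢ p∈ p∉ refl = p∉ (prtS-Ms⁺ p∈)

  no-merge : ∀ {h h′} → h ≢ h′ → ¬ MergeCond M (block 𝒫 h) (block 𝒫 h′)
  no-merge {h} {h′} h≢h′ merge with rest , 𝒫↭ ← lookup₂-↭ 𝒫 h h′ h≢h′ =
    final (_ , _ , _ , rest , 𝒫↭ , refl , merge)

  isPartition : PPartition M 𝒫 Ms
  isPartition = record
    { wf       = λ h → restrict-wf wf
    ; sub      = λ h p P p∈ → proj₁ (⟦⟧∈-Ms⁻ p∈)
    ; cover    = λ p p∈ → let h , p∈B = blockOf p∈ in h , prtS-Ms⁺ p∈B
    ; disjoint = λ h h′ p p∈ p∈′ → blocks-disjoint h h′ (prtS-Ms⁻ p∈) (prtS-Ms⁻ p∈′)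
    ; inBlock  = λ h p → prtS-Ms⁻
    }

  condI : ∀ h p P → p ⟦ P ⟧∈ Ms h →
          Connector (Ms h) p ⊎ (∀ q → q ∈prt P → prtS M q → prtS (Ms h) q)
  condI h p P p∈Ms with anyPrt? P (λ q → prtS? M q ×-dec ¬? (prtS? (Ms h) q))
  ... | no ∄q = inj₂ λ q q∈P q∈M →
    decidable-stable (prtS? (Ms h) q) (λ q∉ → ∄q (q , q∈P , q∈M , q∉))
  ... | yes (q , q∈P , q∈M , q∉) with h′ , q∈B′ ← blockOf q∈M =
    inj₁ (P , p∈Ms , Connecting-mono (λ {q} → prtS-Ms⁺ {h} {q}) conn , q , q∈P , q∉)
    where
      ¬¬conn : ¬ ¬ Connecting (_∈ block 𝒫 h) P
      ¬¬conn ¬conn with p∈M , p∈B ← ⟦⟧∈-Ms⁻ p∈Ms =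
        no-merge (outside⇒≢ q∈B′ q∉) (p , P , q , p∈M , p∈B , q∈B′ , q∈P , inj₁ ¬conn)

      conn : Connecting (_∈ block 𝒫 h) P
      conn = Connecting-stable (_∈ block 𝒫 h) ¬¬conn

  condII : ∀ h p → Connector (Ms h) p →
           ∀ P → p ⟦ P ⟧∈ Ms h →
           ∀ q → q ∈prt P → ¬ prtS (Ms h) q →
           ∀ k → prtS (Ms k) q → Connector (Ms k) q
  condII h p _ P p∈Ms q q∈P q∉ k (Q , q∈Ms) = Connector-stable (restrict-wf wf) q∈Ms ¬¬conn
    where
      ¬¬conn : ¬ ¬ Connector (Ms k) q
      ¬¬conn ¬conn with p∈M , p∈B ← ⟦⟧∈-Ms⁻ p∈Ms | q∈B ← proj₂ (⟦⟧∈-Ms⁻ q∈Ms) =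
        no-merge (outside⇒≢ q∈B q∉) (p , P , q , p∈M , p∈B , q∈B , q∈P , inj₂ ¬conn)

  modularisation : PModularisation M 𝒫 Ms
  modularisation = record { partition = isPartition ; condI = condI ; condII = condII }

mainTheorem4 : (M : Session) → WfSession M → (𝒫 : Partition) →
    Steps M (𝒫₀ M) 𝒫 → Final M 𝒫 → Modularisable M 𝒫
mainTheorem4 M wf 𝒫 steps final = Ms , modularisation
  where open FixedPoint M wf 𝒫 (Steps-covers steps (𝒫₀-covers M)) final
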